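{- Let $A$ be a finite abelian group of even order. The trivial subgroup $\{0\}$ is a subgroup perfect code of $A$ if and only if $A$ is an elementary abelian $2$-group.
   Context: Groups are written additively. An element $x\in A$ is a square if $x=2y$ for some $y\in A$; a subset is square-free if it contains no squares. For a square-free $T\subseteq A$, $\mathrm{CayS}(A,T)$ is the simple graph with vertex set $A$ where distinct $x,y$ are adjacent iff $x+y\in T$. A subset $C$ of vertices of a graph is a perfect code if every vertex is at distance at most one from exactly one vertex of $C$. A subgroup $H$ of $A$ is a subgroup perfect code of $A$ if $H$ is a perfect code of $\mathrm{CayS}(A,T)$ for some square-free $T\subseteq A$. -}

module Defs where

open import Level using (Level; 0ℓ; suc)
open import Algebra.Bundles using (AbelianGroup)
open import Data.Nat using (ℕ)
open import Data.Fin using (Fin)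
open import Data.Product using (Σ; ∃; _×_; _,_)
open import Data.Sum using (_⊎_)
open import Relation.Nullary using (¬_)
open import Relation.Unary using (Pred)
open import Function.Bundles using (Bijection)
import Relation.Binary.PropositionalEquality as ≡

module _ (A : AbelianGroup 0ℓ 0ℓ) where
  open AbelianGroup A renaming (_∙_ to _+_; ε to 0#)

  HasOrder : ℕ → Set
  HasOrder n = Bijection setoid (≡.setoid (Fin n))

  IsSquare : Carrier → Set
  IsSquare x = ∃ λ y → x ≈ y + y

  Respects : Pred Carrier 0ℓ → Set
  Respects S = ∀ {x y} → x ≈ y → S x → S y

  SquareFree : Pred Carrier 0ℓ → Set
  SquareFree T = ∀ x → T x → ¬ IsSquare x

  CaySAdj : Pred Carrier 0ℓ → Carrier → Carrier → Set
  CaySAdj T x y = ¬ (x ≈ y) × T (x + y)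

  WithinOne : Pred Carrier 0ℓ → Carrier → Carrier → Set
  WithinOne T c v = c ≈ v ⊎ CaySAdj T c v

  IsPerfectCode : Pred Carrier 0ℓ → Pred Carrier 0ℓ → Set
  IsPerfectCode T C =
    ∀ v → (∃ λ c → C c × WithinOne T c v)
        × (∀ c c′ → C c → WithinOne T c v → C c′ → WithinOne T c′ v → c ≈ c′)

  SubgroupPerfectCode : Pred Carrier 0ℓ → Set₁
  SubgroupPerfectCode H =
    ∃ λ (T : Pred Carrier 0ℓ) → Respects T × SquareFree T × IsPerfectCode T H

  TrivialSubgroup : Pred Carrier 0ℓ
  TrivialSubgroup x = x ≈ 0#

  IsElementaryAbelian2 : Set
  IsElementaryAbelian2 = ∀ x → x + x ≈ 0#

module Submission where

-- The trivial subgroup {0} is a perfect code of CayS(A,T) exactly when every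
-- vertex v satisfies v ≈ 0 or v ∈ T (its neighbour 0 is then unique, since
-- {0} has a single element up to ≈).
--
-- (⇒) For any square-free T the square x + x is never adjacent to 0, because
--     0 + (x + x) ≈ x + x ∉ T; hence covering the vertex x + x forces
--     x + x ≈ 0, i.e. A is an elementary abelian 2-group.
-- (⇐) If A is an elementary abelian 2-group, every square is 0, so the set
--     T of non-zero elements is square-free; it makes {0} a perfect code as
--     soon as equality in A is decidable, which holds for finite A.

open import Defs
open import Level using (0ℓ)
open import Algebra.Bundles using (AbelianGroup)
open import Data.Nat using (ℕ)
open import Data.Nat.Divisibility using (_∣_)
open import Data.Fin.Properties using (_≟_)
open import Data.Product using (_,_; proj₁)
open import Data.Sum using (inj₁; inj₂)
open import Data.Empty using (⊥-elim)
open import Function.Bundles using (_⇔_; mk⇔; Bijection)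
open import Relation.Nullary using (¬_; yes; no)
open import Relation.Unary using (Pred)
open import Relation.Binary.Definitions using (Decidable)

module TrivialCode (A : AbelianGroup 0ℓ 0ℓ) where
  open AbelianGroup A renaming (_∙_ to _+_; ε to 0#)

  finite⇒decidable : ∀ {n} → HasOrder A n → Decidable _≈_
  finite⇒decidable bij x y with Bijection.to bij x ≟ Bijection.to bij y
  ... | yes fx≡fy = yes (Bijection.injective bij fx≡fy)
  ... | no fx≢fy  = no (λ x≈y → fx≢fy (Bijection.cong bij x≈y))

  square-not-adjacent-to-0 : ∀ {T} → Respects A T → SquareFree A T →
    ∀ {c} → c ≈ 0# → ∀ x → ¬ CaySAdj A T c (x + x)
  square-not-adjacent-to-0 resp sf c≈0 x (_ , Tcxx) =
    sf (x + x) (resp (trans (∙-congʳ c≈0) (identityˡ (x + x))) Tcxx) (x , refl)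

  code⇒elementary : SubgroupPerfectCode A (TrivialSubgroup A) →
    IsElementaryAbelian2 A
  code⇒elementary (T , resp , sf , pc) x with proj₁ (pc (x + x))
  ... | c , c≈0 , inj₁ c≈xx = trans (sym c≈xx) c≈0
  ... | c , c≈0 , inj₂ adj  =
    ⊥-elim (square-not-adjacent-to-0 resp sf c≈0 x adj)

  NonZero : Pred Carrier 0ℓ
  NonZero x = ¬ (x ≈ 0#)

  nonZero-respects : Respects A NonZero
  nonZero-respects x≈y x≉0 y≈0 = x≉0 (trans x≈y y≈0)

  nonZero-squareFree : IsElementaryAbelian2 A → SquareFree A NonZero
  nonZero-squareFree e2 x x≉0 (y , x≈yy) = x≉0 (trans x≈yy (e2 y))

  within-one-of-0 : Decidable _≈_ → ∀ v → WithinOne A NonZero 0# v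
  within-one-of-0 _≟ₐ_ v with 0# ≟ₐ v
  ... | yes 0≈v = inj₁ 0≈v
  ... | no 0≉v  = inj₂ (0≉v , λ 0+v≈0 → 0≉v (sym (trans (sym (identityˡ v)) 0+v≈0)))

  trivial-unique : ∀ {c c′} → c ≈ 0# → c′ ≈ 0# → c ≈ c′
  trivial-unique c≈0 c′≈0 = trans c≈0 (sym c′≈0)

  elementary⇒code : Decidable _≈_ → IsElementaryAbelian2 A →
    SubgroupPerfectCode A (TrivialSubgroup A)
  elementary⇒code dec e2 =
    NonZero , nonZero-respects , nonZero-squareFree e2 ,
    λ v → (0# , refl , within-one-of-0 dec v) ,
          λ _ _ c≈0 _ c′≈0 _ → trivial-unique c≈0 c′≈0

corollary3p7 : (A : AbelianGroup 0ℓ 0ℓ) (n : ℕ) → HasOrder A n → 2 ∣ n →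
    (SubgroupPerfectCode A (TrivialSubgroup A) ⇔ IsElementaryAbelian2 A)
corollary3p7 A n order _ =
  mk⇔ code⇒elementary (elementary⇒code (finite⇒decidable order))
  where open TrivialCode A
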